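{- Let $B$ be a Boolean algebra (viewed as a de Morgan algebra with $x^{\circ}$ the complement of $x$), $D$ a bounded distributive lattice, and $\varphi: B\to D$ a $(0,1)$-lattice homomorphism. Let $$L=\{(x,y)\mid x\in B,\ y\in D,\ y\le \varphi(x)\}$$ with operations $(x_1,y_1)\vee(x_2,y_2)=(x_1\vee x_2,y_1\vee y_2)$, $(x_1,y_1)\wedge(x_2,y_2)=(x_1\wedge x_2,y_1\wedge y_2)$, $(x,y)^{\circ}=(x^{\circ},\varphi(x^{\circ}))$, $0_L=(0,0)$, $1_L=(1,1)$. Then $L$ is a principal Stone algebra (i.e. a principal MS-algebra which is a Stone algebra), and $L^{\vee}=D(L)$ and $L^{\wedge}=\{0_L\}$, where $L^{\vee}=\{u\vee u^{\circ}\mid u\in L\}$ and $L^{\wedge}=\{u\wedge u^{\circ}\mid u\in L\}$.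
   Context: An MS-algebra is an algebra $(L;\vee,\wedge,{}^{\circ},0,1)$ where $(L;\vee,\wedge,0,1)$ is a bounded distributive lattice and ${}^{\circ}$ is a unary operation with $x\le x^{\circ\circ}$, $(x\wedge y)^{\circ}=x^{\circ}\vee y^{\circ}$ and $1^{\circ}=0$. A Stone algebra is an MS-algebra satisfying $x\wedge x^{\circ}=0$ (equivalently here, $x^{\circ}\vee x^{\circ\circ}=1$). For an MS-algebra $L$, $D(L)=\{x\in L\mid x^{\circ}=0\}$ is the filter of dense elements. An MS-algebra $L$ is principal if there is $d_L\in L$ with $D(L)=\{x\in L\mid x\ge d_L\}$ and $x=x^{\circ\circ}\wedge(x\vee d_L)$ for all $x\in L$. -}

module Defs where

open import Level using (Level; _⊔_; suc)
open import Data.Product using (Σ; _×_; _,_; proj₁; proj₂; ∃)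
open import Function.Bundles using (_⇔_)
open import Relation.Binary.Core using (Rel)
open import Algebra.Core using (Op₁; Op₂)
open import Algebra.Definitions using (Congruent₁)
open import Algebra.Lattice.Structures using (IsDistributiveLattice)
open import Algebra.Lattice.Bundles using (BooleanAlgebra; DistributiveLattice; RawLattice)
open import Algebra.Lattice.Morphism.Structures using (module LatticeMorphisms)
import Algebra.Definitions as AD
import Algebra.Lattice.Properties.Lattice as LatticeProps
import Relation.Binary.Lattice as RL

private
  variable
    a ℓ b ℓ₁ c₂ ℓ₂ : Level

LatticeLeq : {A : Set a} → Rel A ℓ → Op₂ A → Rel A ℓ
LatticeLeq _≈_ _∧_ x y = x ≈ (x ∧ y)

record IsBoundedDistributiveLattice {A : Set a} (_≈_ : Rel A ℓ)
         (_∨_ _∧_ : Op₂ A) (⊤ ⊥ : A) : Set (a ⊔ ℓ) where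
  field
    isDistributiveLattice : IsDistributiveLattice _≈_ _∨_ _∧_
    ∧-identity            : AD.Identity _≈_ ⊤ _∧_
    ∨-identity            : AD.Identity _≈_ ⊥ _∨_
  open IsDistributiveLattice isDistributiveLattice public

record BoundedDistributiveLattice c ℓ : Set (suc (c ⊔ ℓ)) where
  field
    Carrier   : Set c
    _≈_       : Rel Carrier ℓ
    _∨_       : Op₂ Carrier
    _∧_       : Op₂ Carrier
    ⊤         : Carrier
    ⊥         : Carrier
    isBoundedDistributiveLattice : IsBoundedDistributiveLattice _≈_ _∨_ _∧_ ⊤ ⊥
  open IsBoundedDistributiveLattice isBoundedDistributiveLattice public

  distributiveLattice : DistributiveLattice c ℓ
  distributiveLattice = record { isDistributiveLattice = isDistributiveLattice }

  open DistributiveLattice distributiveLattice public using (rawLattice; lattice)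

record IsMSAlgebra {A : Set a} (_≈_ : Rel A ℓ)
         (_∨_ _∧_ : Op₂ A) (_° : Op₁ A) (⊤ ⊥ : A) : Set (a ⊔ ℓ) where
  field
    isBoundedDistributiveLattice : IsBoundedDistributiveLattice _≈_ _∨_ _∧_ ⊤ ⊥
    °-cong  : Congruent₁ _≈_ _°
    x≤x°°   : ∀ x → LatticeLeq _≈_ _∧_ x ((x °) °)
    °-∧     : ∀ x y → ((x ∧ y) °) ≈ ((x °) ∨ (y °))
    ⊤°≈⊥    : (⊤ °) ≈ ⊥
  open IsBoundedDistributiveLattice isBoundedDistributiveLattice public

record IsStoneAlgebra {A : Set a} (_≈_ : Rel A ℓ)
         (_∨_ _∧_ : Op₂ A) (_° : Op₁ A) (⊤ ⊥ : A) : Set (a ⊔ ℓ) where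
  field
    isMSAlgebra : IsMSAlgebra _≈_ _∨_ _∧_ _° ⊤ ⊥
    x∧x°≈⊥      : ∀ x → (x ∧ (x °)) ≈ ⊥
  open IsMSAlgebra isMSAlgebra public

IsDense : {A : Set a} → Rel A ℓ → Op₁ A → A → A → Set ℓ
IsDense _≈_ _° ⊥ x = (x °) ≈ ⊥

record IsPrincipalMSAlgebra {A : Set a} (_≈_ : Rel A ℓ)
         (_∨_ _∧_ : Op₂ A) (_° : Op₁ A) (⊤ ⊥ : A) : Set (a ⊔ ℓ) where
  field
    isMSAlgebra : IsMSAlgebra _≈_ _∨_ _∧_ _° ⊤ ⊥
    d           : A
    dense⇔≥d    : ∀ x → IsDense _≈_ _° ⊥ x ⇔ LatticeLeq _≈_ _∧_ d x
    decompose   : ∀ x → x ≈ (((x °) °) ∧ (x ∨ d))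

record IsPrincipalStoneAlgebra {A : Set a} (_≈_ : Rel A ℓ)
         (_∨_ _∧_ : Op₂ A) (_° : Op₁ A) (⊤ ⊥ : A) : Set (a ⊔ ℓ) where
  field
    isPrincipalMSAlgebra : IsPrincipalMSAlgebra _≈_ _∨_ _∧_ _° ⊤ ⊥
    isStoneAlgebra       : IsStoneAlgebra _≈_ _∨_ _∧_ _° ⊤ ⊥

record Is01LatticeHomomorphism (B : BooleanAlgebra b ℓ₁)
         (D : BoundedDistributiveLattice c₂ ℓ₂)
         (φ : BooleanAlgebra.Carrier B → BoundedDistributiveLattice.Carrier D)
         : Set (b ⊔ ℓ₁ ⊔ ℓ₂) where
  private
    module B = BooleanAlgebra B
    module D = BoundedDistributiveLattice D
  field
    isLatticeHomomorphism :
      LatticeMorphisms.IsLatticeHomomorphism B.rawLattice D.rawLattice φ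
    ⊤-homo : φ B.⊤ D.≈ D.⊤
    ⊥-homo : φ B.⊥ D.≈ D.⊥
  open LatticeMorphisms.IsLatticeHomomorphism isLatticeHomomorphism public

module Construction (B : BooleanAlgebra b ℓ₁)
                    (D : BoundedDistributiveLattice c₂ ℓ₂)
                    (φ : BooleanAlgebra.Carrier B → BoundedDistributiveLattice.Carrier D)
                    (hom : Is01LatticeHomomorphism B D φ) where
  private
    module B = BooleanAlgebra B
    module D = BoundedDistributiveLattice D
    module H = Is01LatticeHomomorphism hom
    module DP = LatticeProps D.lattice
    module DO = RL.IsLattice DP.∨-∧-isOrderTheoreticLattice

  _≤D_ : Rel D.Carrier ℓ₂
  _≤D_ = LatticeLeq D._≈_ D._∧_

  record Elt : Set (b ⊔ c₂ ⊔ ℓ₂) where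
    constructor elt
    field
      fst : B.Carrier
      snd : D.Carrier
      snd≤φfst : snd ≤D φ fst
  open Elt public

  private
    ≤-resp : ∀ {y u v} → u D.≈ v → y ≤D u → y ≤D v
    ≤-resp u≈v y≤u = proj₁ DO.≤-resp-≈ u≈v y≤u

    ∨-closed : ∀ {x₁ y₁ x₂ y₂} → y₁ ≤D φ x₁ → y₂ ≤D φ x₂ →
               (y₁ D.∨ y₂) ≤D φ (x₁ B.∨ x₂)
    ∨-closed {x₁} {y₁} {x₂} {y₂} p q =
      ≤-resp (D.sym (H.∨-homo x₁ x₂))
        (DO.∨-least (DO.trans p (DO.x≤x∨y _ _)) (DO.trans q (DO.y≤x∨y _ _)))

    ∧-closed : ∀ {x₁ y₁ x₂ y₂} → y₁ ≤D φ x₁ → y₂ ≤D φ x₂ →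
               (y₁ D.∧ y₂) ≤D φ (x₁ B.∧ x₂)
    ∧-closed {x₁} {y₁} {x₂} {y₂} p q =
      ≤-resp (D.sym (H.∧-homo x₁ x₂))
        (DO.∧-greatest (DO.trans (DO.x∧y≤x _ _) p) (DO.trans (DO.x∧y≤y _ _) q))

  _≈L_ : Rel Elt (ℓ₁ ⊔ ℓ₂)
  u ≈L v = (fst u B.≈ fst v) × (snd u D.≈ snd v)

  _∨L_ : Op₂ Elt
  elt x₁ y₁ p ∨L elt x₂ y₂ q = elt (x₁ B.∨ x₂) (y₁ D.∨ y₂) (∨-closed p q)

  _∧L_ : Op₂ Elt
  elt x₁ y₁ p ∧L elt x₂ y₂ q = elt (x₁ B.∧ x₂) (y₁ D.∧ y₂) (∧-closed p q)

  _°L : Op₁ Elt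
  elt x y p °L = elt (B.¬ x) (φ (B.¬ x)) DO.refl

  0L : Elt
  0L = elt B.⊥ D.⊥ (DO.reflexive (D.sym H.⊥-homo))

  1L : Elt
  1L = elt B.⊤ D.⊤ (DO.reflexive (D.sym H.⊤-homo))

  InLJoin : Elt → Set (b ⊔ c₂ ⊔ ℓ₁ ⊔ ℓ₂)
  InLJoin z = ∃ λ u → z ≈L (u ∨L (u °L))

  InLMeet : Elt → Set (b ⊔ c₂ ⊔ ℓ₁ ⊔ ℓ₂)
  InLMeet z = ∃ λ u → z ≈L (u ∧L (u °L))

module Submission where

-- L is a sublattice of B × D containing (0,0) and (1,1), hence a bounded
-- distributive lattice componentwise.  The rest rests on two observations:
--   * φ(x) and φ(¬x) are disjoint in D, so y ≤ φ(x) gives u ∧ u° = 0;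
--   * u° only depends on the first component: (x , y) is dense iff x = 1.
-- As ¬¬x = x, u°° = (x , φ(x)) and the MS-axioms are those of B carried
-- along φ.  By the density criterion D(L) is the principal filter of
-- d = (1 , 0), and u = u°° ∧ (u ∨ d) reduces to y = φ(x) ∧ y.  Finally
-- u ∨ u° has first component x ∨ ¬x = 1 and a dense z equals z ∨ z° = z ∨ 0,
-- so L^∨ = D(L); the Stone identity says L^∧ = {0}.

open import Level using (Level)
open import Defs
open import Data.Product using (_×_; _,_; proj₁; proj₂)
open import Function.Bundles using (_⇔_; mk⇔)
open import Algebra.Lattice.Bundles using (BooleanAlgebra; DistributiveLattice)
open import Relation.Binary.Structures using (IsEquivalence)
open import Algebra.Lattice.Structures using (IsDistributiveLattice)
import Algebra.Lattice.Properties.BooleanAlgebra as BooleanAlgebraProperties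
import Relation.Binary.Reasoning.Setoid as SetoidReasoning

private
  variable
    b c ℓ ℓ₁ ℓ₂ : Level

module BoundedDistributiveLatticeProperties
    (D : BoundedDistributiveLattice c ℓ) where
  open BoundedDistributiveLattice D
  open SetoidReasoning (DistributiveLattice.setoid distributiveLattice)

  ∧-zeroˡ : ∀ y → (⊥ ∧ y) ≈ ⊥
  ∧-zeroˡ y = begin
    ⊥ ∧ y        ≈⟨ ∧-cong refl (proj₁ ∨-identity y) ⟨
    ⊥ ∧ (⊥ ∨ y)  ≈⟨ proj₂ absorptive ⊥ y ⟩
    ⊥            ∎

  ∧-zeroʳ : ∀ y → (y ∧ ⊥) ≈ ⊥
  ∧-zeroʳ y = trans (∧-comm y ⊥) (∧-zeroˡ y)

module HomomorphismProperties
    (B : BooleanAlgebra b ℓ₁) (D : BoundedDistributiveLattice c ℓ₂)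
    (φ : BooleanAlgebra.Carrier B → BoundedDistributiveLattice.Carrier D)
    (hom : Is01LatticeHomomorphism B D φ) where
  private
    module B = BooleanAlgebra B
    module BP = BooleanAlgebraProperties B
    module D = BoundedDistributiveLattice D
    module H = Is01LatticeHomomorphism hom

  φ-disjoint : ∀ x → (φ x D.∧ φ (B.¬ x)) D.≈ D.⊥
  φ-disjoint x = begin
    φ x ∧ φ (¬ x)   ≈⟨ H.∧-homo x (¬ x) ⟨
    φ (x B.∧ ¬ x)   ≈⟨ H.⟦⟧-cong (B.∧-complementʳ x) ⟩
    φ B.⊥           ≈⟨ H.⊥-homo ⟩
    ⊥               ∎
    where
      open D using (_∧_; ⊥)
      open B using (¬_)
      open SetoidReasoning (DistributiveLattice.setoid D.distributiveLattice)

  φ-¬-involutive : ∀ x → φ (B.¬ (B.¬ x)) D.≈ φ x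
  φ-¬-involutive x = H.⟦⟧-cong (BP.¬-involutive x)

  φ-¬⊤ : φ (B.¬ B.⊤) D.≈ D.⊥
  φ-¬⊤ = D.trans (H.⟦⟧-cong BP.¬⊤≈⊥) H.⊥-homo

module ConstructionProperties
    (B : BooleanAlgebra b ℓ₁) (D : BoundedDistributiveLattice c ℓ₂)
    (φ : BooleanAlgebra.Carrier B → BoundedDistributiveLattice.Carrier D)
    (hom : Is01LatticeHomomorphism B D φ) where
  open Construction B D φ hom
  private
    module B = BooleanAlgebra B
    module BP = BooleanAlgebraProperties B
    module D = BoundedDistributiveLattice D
    module DP = BoundedDistributiveLatticeProperties D
    module H = Is01LatticeHomomorphism hom
    open HomomorphismProperties B D φ hom
    module BR = SetoidReasoning B.setoid
    module DR = SetoidReasoning (DistributiveLattice.setoid D.distributiveLattice)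

  ≈L-isEquivalence : IsEquivalence _≈L_
  ≈L-isEquivalence = record
    { refl  = B.refl , D.refl
    ; sym   = λ (p , q) → B.sym p , D.sym q
    ; trans = λ (p , q) (r , s) → B.trans p r , D.trans q s
    }

  isDistributiveLattice : IsDistributiveLattice _≈L_ _∨L_ _∧L_
  isDistributiveLattice = record
    { isLattice = record
      { isEquivalence = ≈L-isEquivalence
      ; ∨-comm  = λ u v → B.∨-comm (fst u) (fst v) , D.∨-comm (snd u) (snd v)
      ; ∨-assoc = λ u v w → B.∨-assoc (fst u) (fst v) (fst w)
                          , D.∨-assoc (snd u) (snd v) (snd w)
      ; ∨-cong  = λ (p , q) (r , s) → B.∨-cong p r , D.∨-cong q s
      ; ∧-comm  = λ u v → B.∧-comm (fst u) (fst v) , D.∧-comm (snd u) (snd v)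
      ; ∧-assoc = λ u v w → B.∧-assoc (fst u) (fst v) (fst w)
                          , D.∧-assoc (snd u) (snd v) (snd w)
      ; ∧-cong  = λ (p , q) (r , s) → B.∧-cong p r , D.∧-cong q s
      ; absorptive =
          (λ u v → proj₁ B.absorptive (fst u) (fst v) , proj₁ D.absorptive (snd u) (snd v))
        , (λ u v → proj₂ B.absorptive (fst u) (fst v) , proj₂ D.absorptive (snd u) (snd v))
      }
    ; ∨-distrib-∧ =
        (λ u v w → proj₁ B.∨-distrib-∧ (fst u) (fst v) (fst w)
                 , proj₁ D.∨-distrib-∧ (snd u) (snd v) (snd w))
      , (λ u v w → proj₂ B.∨-distrib-∧ (fst u) (fst v) (fst w)
                 , proj₂ D.∨-distrib-∧ (snd u) (snd v) (snd w))
    ; ∧-distrib-∨ =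
        (λ u v w → proj₁ B.∧-distrib-∨ (fst u) (fst v) (fst w)
                 , proj₁ D.∧-distrib-∨ (snd u) (snd v) (snd w))
      , (λ u v w → proj₂ B.∧-distrib-∨ (fst u) (fst v) (fst w)
                 , proj₂ D.∧-distrib-∨ (snd u) (snd v) (snd w))
    }

  isBoundedDistributiveLattice : IsBoundedDistributiveLattice _≈L_ _∨L_ _∧L_ 1L 0L
  isBoundedDistributiveLattice = record
    { isDistributiveLattice = isDistributiveLattice
    ; ∧-identity = (λ u → BP.∧-identityˡ (fst u) , proj₁ D.∧-identity (snd u))
                 , (λ u → BP.∧-identityʳ (fst u) , proj₂ D.∧-identity (snd u))
    ; ∨-identity = (λ u → BP.∨-identityˡ (fst u) , proj₁ D.∨-identity (snd u))
                 , (λ u → BP.∨-identityʳ (fst u) , proj₂ D.∨-identity (snd u))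
    }

  stone : ∀ u → (u ∧L (u °L)) ≈L 0L
  stone (elt x y y≤φx) = B.∧-complementʳ x , second
    where
      open DR
      open D using (_∧_; ⊥)
      second : (y ∧ φ (B.¬ x)) D.≈ ⊥
      second = begin
        y ∧ φ (B.¬ x)             ≈⟨ D.∧-cong y≤φx D.refl ⟩
        (y ∧ φ x) ∧ φ (B.¬ x)     ≈⟨ D.∧-assoc y (φ x) (φ (B.¬ x)) ⟩
        y ∧ (φ x ∧ φ (B.¬ x))     ≈⟨ D.∧-cong D.refl (φ-disjoint x) ⟩
        y ∧ ⊥                     ≈⟨ DP.∧-zeroʳ y ⟩
        ⊥                         ∎

  x≤x°° : ∀ u → LatticeLeq _≈L_ _∧L_ u ((u °L) °L)
  x≤x°° (elt x y y≤φx) = first , second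
    where
      first : x B.≈ (x B.∧ B.¬ (B.¬ x))
      first = BR.begin
        x                   BR.≈⟨ BP.∧-idem x ⟨
        x B.∧ x             BR.≈⟨ B.∧-cong B.refl (BP.¬-involutive x) ⟨
        x B.∧ B.¬ (B.¬ x)   BR.∎
      second : y D.≈ (y D.∧ φ (B.¬ (B.¬ x)))
      second = D.trans y≤φx (D.∧-cong D.refl (D.sym (φ-¬-involutive x)))

  °-∧ : ∀ u v → ((u ∧L v) °L) ≈L ((u °L) ∨L (v °L))
  °-∧ u v = BP.deMorgan₁ x₁ x₂
          , D.trans (H.⟦⟧-cong (BP.deMorgan₁ x₁ x₂)) (H.∨-homo (B.¬ x₁) (B.¬ x₂))
    where
      x₁ = fst u
      x₂ = fst v

  isMSAlgebra : IsMSAlgebra _≈L_ _∨L_ _∧L_ _°L 1L 0L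
  isMSAlgebra = record
    { isBoundedDistributiveLattice = isBoundedDistributiveLattice
    ; °-cong = λ (p , _) → B.¬-cong p , H.⟦⟧-cong (B.¬-cong p)
    ; x≤x°°  = x≤x°°
    ; °-∧    = °-∧
    ; ⊤°≈⊥   = BP.¬⊤≈⊥ , φ-¬⊤
    }

  isStoneAlgebra : IsStoneAlgebra _≈L_ _∨L_ _∧L_ _°L 1L 0L
  isStoneAlgebra = record { isMSAlgebra = isMSAlgebra ; x∧x°≈⊥ = stone }

  dense⇒fst≈⊤ : ∀ u → IsDense _≈L_ _°L 0L u → fst u B.≈ B.⊤
  dense⇒fst≈⊤ (elt x y _) (¬x≈⊥ , _) = BR.begin
    x               BR.≈⟨ BP.¬-involutive x ⟨
    B.¬ (B.¬ x)     BR.≈⟨ B.¬-cong ¬x≈⊥ ⟩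
    B.¬ B.⊥         BR.≈⟨ BP.¬⊥≈⊤ ⟩
    B.⊤             BR.∎

  fst≈⊤⇒dense : ∀ u → fst u B.≈ B.⊤ → IsDense _≈L_ _°L 0L u
  fst≈⊤⇒dense u x≈⊤ = B.trans (B.¬-cong x≈⊤) BP.¬⊤≈⊥
                     , D.trans (H.⟦⟧-cong (B.¬-cong x≈⊤)) φ-¬⊤

  dL : Elt
  dL = elt B.⊤ D.⊥ (D.sym (DP.∧-zeroˡ (φ B.⊤)))

  -- d ≤ (x , y) says exactly 1 ≤ x, as 0 ≤ y always holds.
  dense⇔≥d : ∀ u → IsDense _≈L_ _°L 0L u ⇔ LatticeLeq _≈L_ _∧L_ dL u
  dense⇔≥d u = mk⇔
    (λ dense → B.trans (B.sym (dense⇒fst≈⊤ u dense)) (B.sym (BP.∧-identityˡ (fst u)))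
             , D.sym (DP.∧-zeroˡ (snd u)))
    (λ (⊤≤x , _) → fst≈⊤⇒dense u (B.trans (B.sym (BP.∧-identityˡ (fst u))) (B.sym ⊤≤x)))

  decompose : ∀ u → u ≈L (((u °L) °L) ∧L (u ∨L dL))
  decompose (elt x y y≤φx) = first , second
    where
      first : x B.≈ (B.¬ (B.¬ x) B.∧ (x B.∨ B.⊤))
      first = BR.begin
        x                               BR.≈⟨ BP.∧-identityʳ x ⟨
        x B.∧ B.⊤                       BR.≈⟨ B.∧-cong (BP.¬-involutive x) (BP.∨-zeroʳ x) ⟨
        B.¬ (B.¬ x) B.∧ (x B.∨ B.⊤)     BR.∎
      second : y D.≈ (φ (B.¬ (B.¬ x)) D.∧ (y D.∨ D.⊥))
      second = DR.begin
        y                               DR.≈⟨ y≤φx ⟩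
        y D.∧ φ x                       DR.≈⟨ D.∧-comm y (φ x) ⟩
        φ x D.∧ y                       DR.≈⟨ D.∧-cong (φ-¬-involutive x) (proj₂ D.∨-identity y) ⟨
        φ (B.¬ (B.¬ x)) D.∧ (y D.∨ D.⊥) DR.∎

  isPrincipalStoneAlgebra : IsPrincipalStoneAlgebra _≈L_ _∨L_ _∧L_ _°L 1L 0L
  isPrincipalStoneAlgebra = record
    { isPrincipalMSAlgebra = record
      { isMSAlgebra = isMSAlgebra
      ; d           = dL
      ; dense⇔≥d    = dense⇔≥d
      ; decompose   = decompose
      }
    ; isStoneAlgebra = isStoneAlgebra
    }

  -- L^∨ = D(L): u ∨ u° has first component x ∨ ¬x = 1, and a dense z
  -- satisfies z = z ∨ 0 = z ∨ z°.
  join⇔dense : ∀ z → InLJoin z ⇔ IsDense _≈L_ _°L 0L z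
  join⇔dense z = mk⇔
    (λ (u , z₁≈ , _) → fst≈⊤⇒dense z (B.trans z₁≈ (B.∨-complementʳ (fst u))))
    (λ dense@(_ , φ¬x≈⊥) →
       z , B.trans (dense⇒fst≈⊤ z dense) (B.sym (B.∨-complementʳ (fst z)))
         , D.sym (D.trans (D.∨-cong D.refl φ¬x≈⊥) (proj₂ D.∨-identity (snd z))))

  -- L^∧ = {0}: by the Stone identity every u ∧ u° is 0, and 0 = 0 ∧ 0°.
  meet⇔zero : ∀ z → InLMeet z ⇔ z ≈L 0L
  meet⇔zero z = mk⇔
    (λ (u , z≈u∧u°) → trans {z} {u ∧L (u °L)} {0L} z≈u∧u° (stone u))
    (λ z≈0 → z , trans {z} {0L} {z ∧L (z °L)} z≈0 (sym {z ∧L (z °L)} {0L} (stone z)))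
    where open IsEquivalence ≈L-isEquivalence

corollary2p5 : ∀ {b ℓ₁ d ℓ₂} (B : BooleanAlgebra b ℓ₁) (D : BoundedDistributiveLattice d ℓ₂)
    (φ : BooleanAlgebra.Carrier B → BoundedDistributiveLattice.Carrier D)
    (hom : Is01LatticeHomomorphism B D φ) →
    let open Construction B D φ hom in
    IsPrincipalStoneAlgebra _≈L_ _∨L_ _∧L_ _°L 1L 0L
    × (∀ z → InLJoin z ⇔ IsDense _≈L_ _°L 0L z)
    × (∀ z → InLMeet z ⇔ z ≈L 0L)
corollary2p5 B D φ hom = isPrincipalStoneAlgebra , join⇔dense , meet⇔zero
  where open ConstructionProperties B D φ hom
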